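{- Let $(a,b)$ be a lexicographically nonincreasing digraphic list of length $n$, and let $(a',b)$ be a digraphic list with $a\ne a'$ and $a\prec a'$. Then $N_2(a,b)>N_2(a',b)$.
   Context: $(a,b)$ denotes $((a_1,b_1),\dots,(a_n,b_n))$ with nonnegative integers; it is lexicographically nonincreasing if $(a_i,b_i)\ge_{lex}(a_{i+1},b_{i+1})$ for all $i$, where $(x,y)\ge_{lex}(x',y')$ iff $x>x'$ or ($x=x'$ and $y\ge y'$). A digraph realization is a digraph without loops and without multiple arcs on labeled vertices $v_1,\dots,v_n$ with indegree $a_i$ and outdegree $b_i$ at $v_i$; $(a,b)$ is digraphic if one exists and $N_2(a,b)$ is the number of them. Majorization: $a\prec a'$ iff $\sum_{i=1}^k a_i\le\sum_{i=1}^k a'_i$ for $k=1,\dots,n-1$ and total sums are equal. -}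

module Defs where

open import Data.Nat using (ℕ; zero; suc; _+_; _≤_; _<_; _>_; _≥_; _∸_)
import Data.Nat as ℕ
open import Data.Bool using (Bool; true; false)
open import Data.Fin using (Fin; toℕ)
open import Data.Fin.Properties using (all?)
open import Data.Vec using (Vec; []; _∷_; lookup; map; toList)
open import Data.List using (List; length; filter; concatMap; take)
open import Data.Nat.ListAction using (sum)
import Data.List as L
open import Data.Product using (_×_; _,_; ∃)
open import Data.Sum using (_⊎_)
open import Relation.Binary.PropositionalEquality using (_≡_)
open import Relation.Nullary using (Dec; ¬_)
open import Relation.Nullary.Decidable using (_×-dec_)

-- A degree list of length n: a (indegrees) and b (outdegrees), indexed by vertices v_i = i : Fin n.

-- Adjacency matrix on labeled vertices Fin n: M[i][j] = true iff there is an arc v_i → v_j.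
-- Using Bool entries excludes multiple arcs automatically.
Adj : ℕ → Set
Adj n = Vec (Vec Bool n) n

bsum : ∀ {m} → Vec Bool m → ℕ
bsum [] = 0
bsum (true ∷ v) = suc (bsum v)
bsum (false ∷ v) = bsum v

outdeg : ∀ {n} → Adj n → Fin n → ℕ
outdeg M i = bsum (lookup M i)

indeg : ∀ {n} → Adj n → Fin n → ℕ
indeg M j = bsum (map (λ row → lookup row j) M)

Loopless : ∀ {n} → Adj n → Set
Loopless M = ∀ i → lookup (lookup M i) i ≡ false

IsRealization : ∀ {n} → Vec ℕ n → Vec ℕ n → Adj n → Set
IsRealization a b M =
  Loopless M × ((∀ i → indeg M i ≡ lookup a i) × (∀ i → outdeg M i ≡ lookup b i))

isRealization? : ∀ {n} (a b : Vec ℕ n) (M : Adj n) → Dec (IsRealization a b M)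
isRealization? a b M =
  all? (λ i → Data.Bool._≟_ (lookup (lookup M i) i) false)
  ×-dec (all? (λ i → indeg M i ℕ.≟ lookup a i)
  ×-dec all? (λ i → outdeg M i ℕ.≟ lookup b i))

Digraphic : ∀ {n} → Vec ℕ n → Vec ℕ n → Set
Digraphic {n} a b = ∃ λ (M : Adj n) → IsRealization a b M

allVecs : ∀ {A : Set} → List A → (m : ℕ) → List (Vec A m)
allVecs xs zero = L.[ [] ]
allVecs xs (suc m) = concatMap (λ x → L.map (x ∷_) (allVecs xs m)) xs

allAdj : (n : ℕ) → List (Adj n)
allAdj n = allVecs (allVecs (true L.∷ false L.∷ L.[]) n) n

N₂ : ∀ {n} → Vec ℕ n → Vec ℕ n → ℕ
N₂ {n} a b = length (filter (isRealization? a b) (allAdj n))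

_≥lex_ : ℕ × ℕ → ℕ × ℕ → Set
(x , y) ≥lex (x' , y') = x > x' ⊎ (x ≡ x' × y ≥ y')

LexNonincreasing : ∀ {n} → Vec ℕ n → Vec ℕ n → Set
LexNonincreasing {n} a b =
  ∀ (i j : Fin n) → toℕ j ≡ suc (toℕ i) →
    (lookup a i , lookup b i) ≥lex (lookup a j , lookup b j)

prefixSum : ∀ {n} → Vec ℕ n → ℕ → ℕ
prefixSum a k = sum (take k (toList a))

_≺_ : ∀ {n} → Vec ℕ n → Vec ℕ n → Set
_≺_ {n} a a' =
  (∀ k → 1 ≤ k → k ≤ n ∸ 1 → prefixSum a k ≤ prefixSum a' k)
  × sum (toList a) ≡ sum (toList a')

-- Starting from w = a′, repeatedly move one unit of w from a position p to a later position q with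
-- a_p < w_p and w_q < a_q; a stays majorized by w and Σ (w_i ∸ a_i) drops, so a is reached. Each move
-- from u to v (u_p = v_p + 1, v_q = u_q + 1, v_q ≤ v_p) does not decrease the number of realizations,
-- by a ballot-style reflection: in the rows other than p and q, weigh an arc into p but not q by +1 and
-- an arc into q but not p by −1. In a realization of u these weights sum to at least 1, and exchanging
-- columns p and q in the shortest final segment of rows of positive weight gives a realization of v;
-- this is injective, and its image consists of the realizations of v with a final segment of negative
-- weight. For the last move (onto a), lexicographic order gives a_q < a_p, or a_p = a_q and b_q ≤ b_p,
-- in which case a switching makes every arc q→p come with an arc p→q. Either way, sorting the rows of a
-- realization of a so that no final segment has negative weight produces a realization outside the
-- image, so the count strictly increases.

module Submission where

open import Defs
open import Data.Nat using (ℕ; _>_)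
open import Data.Vec using (Vec)
open import Relation.Binary.PropositionalEquality using (_≢_; refl)

module Counting where

  open import Level using (0ℓ)
  open import Data.Nat using (zero; suc; _≤_; _<_; z≤n; s≤s)
  open import Data.Bool using (true; false)
  open import Data.Vec using (Vec; []; _∷_)
  open import Data.Vec.Properties using (∷-injective)
  open import Data.List using (List; []; _∷_; length; filter; map; cartesianProductWith; _++_)
  import Data.List as List
  open import Data.List.Properties using (length-map; map-∘; map-id-local; length-removeAt′)
  open import Data.List.Relation.Unary.Any using (here; there; _─_)
  open import Data.List.Relation.Unary.All as All using (All; []; _∷_)
  open import Data.List.Relation.Unary.All.Properties using (all-filter)
  open import Data.List.Membership.Propositional using (_∈_)
  open import Data.List.Membership.Propositional.Properties
    using (∈-map⁻; ∈-filter⁺; ∈-filter⁻; ∈-cartesianProductWith⁺)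
  open import Data.List.Relation.Binary.Subset.Propositional using (_⊆_)
  open import Data.List.Relation.Unary.Unique.Propositional using (Unique; []; _∷_)
  import Data.List.Relation.Unary.Unique.Propositional.Properties as Unique
  open import Data.Product using (_,_; proj₂)
  open import Data.Empty using (⊥-elim)
  open import Relation.Unary using (Pred; Decidable)
  open import Relation.Binary.PropositionalEquality using (_≡_; _≢_; refl; sym; trans; cong; subst)

  ∈-─⁺ : ∀ {A : Set} {x y : A} {xs} (x∈xs : x ∈ xs) → y ∈ xs → y ≢ x → y ∈ (xs ─ x∈xs)
  ∈-─⁺ (here refl) (here refl) y≢x = ⊥-elim (y≢x refl)
  ∈-─⁺ (here refl) (there y∈xs) _ = y∈xs
  ∈-─⁺ (there x∈xs) (here refl) _ = here refl
  ∈-─⁺ (there x∈xs) (there y∈xs) y≢x = there (∈-─⁺ x∈xs y∈xs y≢x)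

  Unique-⊆⇒length≤ : ∀ {A : Set} {xs ys : List A} → Unique xs → xs ⊆ ys → length xs ≤ length ys
  Unique-⊆⇒length≤ [] _ = z≤n
  Unique-⊆⇒length≤ {xs = x ∷ xs} {ys} (x∉xs ∷ xs!) xs⊆ys =
    subst (suc (length xs) ≤_) (sym (length-removeAt′ ys _))
      (s≤s (Unique-⊆⇒length≤ xs! λ y∈xs →
        ∈-─⁺ x∈ys (xs⊆ys (there y∈xs)) (λ y≡x → All.lookup x∉xs y∈xs (sym y≡x))))
    where x∈ys = xs⊆ys (here refl)

  module _ {A B : Set} {P : Pred A 0ℓ} {Q : Pred B 0ℓ} (P? : Decidable P) (Q? : Decidable Q)
           {xs : List A} {ys : List B} (xs! : Unique xs) (ys-complete : ∀ y → y ∈ ys)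
           (f : A → B) (g : B → A) (f-resp : ∀ {x} → P x → Q (f x)) (g∘f : ∀ {x} → P x → g (f x) ≡ x)
           where

    private
      image = map f (filter P? xs)

      image! : Unique image
      image! = Unique.map⁻ (subst Unique (sym g∘f-on-filter) (Unique.filter⁺ P? xs!))
        where
        g∘f-on-filter : map g image ≡ filter P? xs
        g∘f-on-filter = trans (sym (map-∘ (filter P? xs)))
                              (map-id-local (All.map g∘f (all-filter P? xs)))

      image⊆ : image ⊆ filter Q? ys
      image⊆ y∈image with ∈-map⁻ f y∈image
      ... | x , x∈ , refl = ∈-filter⁺ Q? (ys-complete (f x)) (f-resp (proj₂ (∈-filter⁻ P? {xs = xs} x∈)))

    length-filter-≤ : length (filter P? xs) ≤ length (filter Q? ys)
    length-filter-≤ = subst (_≤ _) (length-map f (filter P? xs)) (Unique-⊆⇒length≤ image! image⊆)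

    length-filter-< : ∀ y → Q y → (∀ {x} → P x → f x ≢ y) → length (filter P? xs) < length (filter Q? ys)
    length-filter-< y Qy missed = subst (λ k → suc k ≤ _) (length-map f (filter P? xs))
      (Unique-⊆⇒length≤ (All.tabulate y∉image ∷ image!) y∷image⊆)
      where
      y∉image : ∀ {z} → z ∈ image → y ≢ z
      y∉image z∈image y≡z with ∈-map⁻ f z∈image
      ... | x , x∈ , refl = missed (proj₂ (∈-filter⁻ P? {xs = xs} x∈)) (sym y≡z)

      y∷image⊆ : y ∷ image ⊆ filter Q? ys
      y∷image⊆ (here refl) = ∈-filter⁺ Q? (ys-complete y) Qy
      y∷image⊆ (there z∈image) = image⊆ z∈image

  concatMap≡cartesianProductWith : ∀ {A : Set} {m} (xs : List A) (vs : List (Vec A m)) →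
    List.concatMap (λ x → map (x ∷_) vs) xs ≡ cartesianProductWith _∷_ xs vs
  concatMap≡cartesianProductWith [] vs = refl
  concatMap≡cartesianProductWith (x ∷ xs) vs = cong (map (x ∷_) vs ++_) (concatMap≡cartesianProductWith xs vs)

  allVecs-complete : ∀ {A : Set} {xs : List A} → (∀ x → x ∈ xs) → ∀ m (v : Vec A m) → v ∈ allVecs xs m
  allVecs-complete complete zero [] = here refl
  allVecs-complete {xs = xs} complete (suc m) (x ∷ v) =
    subst (x ∷ v ∈_) (sym (concatMap≡cartesianProductWith xs (allVecs xs m)))
      (∈-cartesianProductWith⁺ _∷_ (complete x) (allVecs-complete complete m v))

  allVecs-unique : ∀ {A : Set} {xs : List A} → Unique xs → ∀ m → Unique (allVecs xs m)
  allVecs-unique xs! zero = [] ∷ []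
  allVecs-unique {xs = xs} xs! (suc m) =
    subst Unique (sym (concatMap≡cartesianProductWith xs (allVecs xs m)))
      (Unique.cartesianProductWith⁺ _∷_ ∷-injective xs! (allVecs-unique xs! m))

  allAdj-complete : ∀ n (M : Adj n) → M ∈ allAdj n
  allAdj-complete n = allVecs-complete (allVecs-complete Bool-complete n) n
    where
    Bool-complete : ∀ b → b ∈ true ∷ false ∷ []
    Bool-complete true = here refl
    Bool-complete false = there (here refl)

  allAdj-unique : ∀ n → Unique (allAdj n)
  allAdj-unique n = allVecs-unique (allVecs-unique (((λ ()) ∷ []) ∷ [] ∷ []) n) n

module Sums where

  open import Data.Nat using (zero; suc; z≤n; s≤s)
  open import Data.Product using (∃; _×_; _,_)
  open import Data.Bool as Bool using (Bool; true; false)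
  open import Data.Fin using (Fin; zero; suc; _≟_)
  open import Data.Fin.Properties using (suc-injective; any?)
  open import Data.Fin.Permutation as Perm using ()
  open import Data.Fin.Permutation.Components using (transpose)
  open import Data.Vec using (Vec; []; _∷_; lookup; tabulate)
  open import Data.Vec.Properties using (lookup∘tabulate; tabulate∘lookup; tabulate-cong)
  open import Data.Integer using (ℤ; +_; _+_; 0ℤ; 1ℤ; _≤_; _<_; +≤+; +<+)
  import Data.Integer.Properties as ℤ
  open import Algebra.Properties.CommutativeMonoid.Sum ℤ.+-0-commutativeMonoid
    using (sum; sum-cong-≗; sum-permute)
  open import Relation.Nullary using (¬_; Dec; yes; no; contradiction)
  open import Relation.Nullary.Decidable using (dec-true; dec-false; decidable-stable; ¬?; _×-dec_)
  open import Relation.Binary.PropositionalEquality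
    using (_≡_; _≢_; refl; sym; trans; cong; cong₂; subst₂; module ≡-Reasoning)
  open import Function using (_∘_)

  lookup-ext : ∀ {A : Set} {n} {xs ys : Vec A n} → (∀ i → lookup xs i ≡ lookup ys i) → xs ≡ ys
  lookup-ext {xs = xs} {ys} eq = trans (sym (tabulate∘lookup xs)) (trans (tabulate-cong eq) (tabulate∘lookup ys))

  transpose-matchˡ : ∀ {n} (x y : Fin n) → transpose x y x ≡ y
  transpose-matchˡ x y rewrite dec-true (x ≟ x) refl = refl

  transpose-matchʳ : ∀ {n} (x y : Fin n) → transpose x y y ≡ x
  transpose-matchʳ x y with y ≟ x
  ... | yes refl = refl
  ... | no _ rewrite dec-true (y ≟ y) refl = refl

  transpose-other : ∀ {n} {x y k : Fin n} → k ≢ x → k ≢ y → transpose x y k ≡ k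
  transpose-other {x = x} {y} {k} k≢x k≢y rewrite dec-false (k ≟ x) k≢x | dec-false (k ≟ y) k≢y = refl

  transpose-involutive : ∀ {n} (x y k : Fin n) → transpose x y (transpose x y k) ≡ k
  transpose-involutive x y k = cases (k ≟ x) (k ≟ y)
    where
    cases : Dec (k ≡ x) → Dec (k ≡ y) → transpose x y (transpose x y k) ≡ k
    cases (yes refl) _ = trans (cong (transpose k y) (transpose-matchˡ k y)) (transpose-matchʳ k y)
    cases (no _) (yes refl) = trans (cong (transpose x k) (transpose-matchʳ x k)) (transpose-matchˡ x k)
    cases (no k≢x) (no k≢y) = trans (cong (transpose x y) (transpose-other k≢x k≢y)) (transpose-other k≢x k≢y)

  sum-transpose : ∀ {n} (x y : Fin n) (f : Fin n → ℤ) → sum f ≡ sum (f ∘ transpose x y)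
  sum-transpose x y f = sum-permute f (Perm.transpose x y)

  ⟦_⟧ : Bool → ℤ
  ⟦ true ⟧ = 1ℤ
  ⟦ false ⟧ = 0ℤ

  bsum≡sum : ∀ {m} (r : Vec Bool m) → + bsum r ≡ sum (λ j → ⟦ lookup r j ⟧)
  bsum≡sum [] = refl
  bsum≡sum (true ∷ r) = trans (ℤ.pos-+ 1 (bsum r)) (cong (_+_ 1ℤ) (bsum≡sum r))
  bsum≡sum (false ∷ r) = trans (bsum≡sum r) (sym (ℤ.+-identityˡ _))

  swapCols : ∀ {A : Set} {n} → Fin n → Fin n → Vec A n → Vec A n
  swapCols x y r = tabulate (lookup r ∘ transpose x y)

  module _ {A : Set} {n} (x y : Fin n) (r : Vec A n) where

    lookup-swapCols : ∀ j → lookup (swapCols x y r) j ≡ lookup r (transpose x y j)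
    lookup-swapCols = lookup∘tabulate _

    lookup-swapColsˡ : lookup (swapCols x y r) x ≡ lookup r y
    lookup-swapColsˡ = trans (lookup-swapCols x) (cong (lookup r) (transpose-matchˡ x y))

    lookup-swapColsʳ : lookup (swapCols x y r) y ≡ lookup r x
    lookup-swapColsʳ = trans (lookup-swapCols y) (cong (lookup r) (transpose-matchʳ x y))

    lookup-swapCols-other : ∀ {j} → j ≢ x → j ≢ y → lookup (swapCols x y r) j ≡ lookup r j
    lookup-swapCols-other j≢x j≢y = trans (lookup-swapCols _) (cong (lookup r) (transpose-other j≢x j≢y))

    swapCols-involutive : swapCols x y (swapCols x y r) ≡ r
    swapCols-involutive = lookup-ext λ j →
      trans (lookup∘tabulate _ j) (trans (lookup-swapCols _) (cong (lookup r) (transpose-involutive x y j)))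

  bsum-swapCols : ∀ {n} (x y : Fin n) (r : Vec Bool n) → bsum (swapCols x y r) ≡ bsum r
  bsum-swapCols x y r = ℤ.+-injective (begin
    + bsum (swapCols x y r)                           ≡⟨ bsum≡sum (swapCols x y r) ⟩
    sum (λ j → ⟦ lookup (swapCols x y r) j ⟧)          ≡⟨ sum-cong-≗ (cong ⟦_⟧ ∘ lookup-swapCols x y r) ⟩
    sum (λ j → ⟦ lookup r (transpose x y j) ⟧)         ≡⟨ sum-transpose x y _ ⟨
    sum (λ j → ⟦ lookup r j ⟧)                         ≡⟨ bsum≡sum r ⟨
    + bsum r                                          ∎)
    where open ≡-Reasoning

  sum-zero : ∀ {n} (g : Fin n → ℤ) → (∀ i → g i ≡ 0ℤ) → sum g ≡ 0ℤ
  sum-zero {zero} g g≡0 = refl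
  sum-zero {suc n} g g≡0 = cong₂ _+_ (g≡0 zero) (sum-zero (g ∘ suc) (g≡0 ∘ suc))

  sum-single : ∀ {n} (x : Fin n) (g : Fin n → ℤ) → (∀ i → i ≢ x → g i ≡ 0ℤ) → sum g ≡ g x
  sum-single zero g g≡0 =
    trans (cong (_+_ (g zero)) (sum-zero (g ∘ suc) (λ i → g≡0 (suc i) λ ()))) (ℤ.+-identityʳ (g zero))
  sum-single (suc x) g g≡0 =
    trans (cong₂ _+_ (g≡0 zero λ ()) (sum-single x (g ∘ suc) (λ i i≢x → g≡0 (suc i) (i≢x ∘ suc-injective))))
          (ℤ.+-identityˡ (g (suc x)))

  sum-pair : ∀ {n} {x y : Fin n} → x ≢ y → (g : Fin n → ℤ) → (∀ i → i ≢ x → i ≢ y → g i ≡ 0ℤ) →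
    sum g ≡ g x + g y
  sum-pair {x = zero} {zero} x≢y g g≡0 = contradiction refl x≢y
  sum-pair {x = zero} {suc y} x≢y g g≡0 =
    cong (_+_ (g zero)) (sum-single y (g ∘ suc) (λ i i≢y → g≡0 (suc i) (λ ()) (i≢y ∘ suc-injective)))
  sum-pair {x = suc x} {zero} x≢y g g≡0 =
    trans (cong (_+_ (g zero)) (sum-single x (g ∘ suc) (λ i i≢x → g≡0 (suc i) (i≢x ∘ suc-injective) (λ ()))))
          (ℤ.+-comm (g zero) (g (suc x)))
  sum-pair {x = suc x} {suc y} x≢y g g≡0 =
    trans (cong₂ _+_ (g≡0 zero (λ ()) (λ ()))
                     (sum-pair (x≢y ∘ cong suc) (g ∘ suc) λ i i≢x i≢y →
                        g≡0 (suc i) (i≢x ∘ suc-injective) (i≢y ∘ suc-injective)))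
          (ℤ.+-identityˡ _)

  sum-mono-≤ : ∀ {n} {g h : Fin n → ℤ} → (∀ i → g i ≤ h i) → sum g ≤ sum h
  sum-mono-≤ {zero} g≤h = ℤ.≤-refl
  sum-mono-≤ {suc n} g≤h = ℤ.+-mono-≤ (g≤h zero) (sum-mono-≤ (g≤h ∘ suc))

  sum-mono-< : ∀ {n} {g h : Fin n → ℤ} → (∀ i → g i ≤ h i) → ∀ x → g x < h x → sum g < sum h
  sum-mono-< g≤h zero gx<hx = ℤ.+-mono-<-≤ gx<hx (sum-mono-≤ (g≤h ∘ suc))
  sum-mono-< g≤h (suc x) gx<hx = ℤ.+-mono-≤-< (g≤h zero) (sum-mono-< (g≤h ∘ suc) x gx<hx)

  ⟦⟧-mono : ∀ {x y} → (x ≡ true → y ≡ true) → ⟦ x ⟧ ≤ ⟦ y ⟧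
  ⟦⟧-mono {false} {false} _ = ℤ.≤-refl
  ⟦⟧-mono {false} {true} _ = +≤+ z≤n
  ⟦⟧-mono {true} {true} _ = ℤ.≤-refl
  ⟦⟧-mono {true} {false} x⇒y with x⇒y refl
  ... | ()

  compensating-index : ∀ {n} (r s : Fin n → Bool) x → r x ≡ false → s x ≡ true →
    sum (⟦_⟧ ∘ s) ≤ sum (⟦_⟧ ∘ r) → ∃ λ i → i ≢ x × r i ≡ true × s i ≡ false
  compensating-index r s x rx sx Σs≤Σr =
    decidable-stable (any? λ i → ¬? (i ≟ x) ×-dec r i Bool.≟ true ×-dec s i Bool.≟ false) λ none →
      ℤ.<-irrefl refl (ℤ.<-≤-trans (sum-mono-< (r≤s none) x rx<sx) Σs≤Σr)
    where
    rx<sx : ⟦ r x ⟧ < ⟦ s x ⟧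
    rx<sx = subst₂ (λ a b → ⟦ a ⟧ < ⟦ b ⟧) (sym rx) (sym sx) (+<+ (s≤s z≤n))
    r≤s : ¬ (∃ λ i → i ≢ x × r i ≡ true × s i ≡ false) → ∀ i → ⟦ r i ⟧ ≤ ⟦ s i ⟧
    r≤s none i with i ≟ x
    ... | yes refl = ⟦⟧-mono λ ri → contradiction (trans (sym rx) ri) λ ()
    ... | no i≢x = ⟦⟧-mono ri⇒si
      where
      ri⇒si : r i ≡ true → s i ≡ true
      ri⇒si ri with s i in si
      ... | true = refl
      ... | false = contradiction (i , i≢x , ri , si) none

module Reflection where

  open import Data.Nat as ℕ using (ℕ; zero; suc; z≤n; s≤s)
  import Data.Nat.Properties as ℕ
  open import Data.Bool using (Bool; true; false)
  open import Data.Vec using (Vec; []; _∷_; lookup; map; replicate; zipWith)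
  open import Data.Vec.Properties using (lookup-zipWith; map-id)
  open import Data.Integer using (ℤ; +_; -_; _+_; _-_; _*_; _⊔_; 0ℤ; 1ℤ; -1ℤ; _≤_; _≤?_; +≤+; -≤+)
  import Data.Integer.Properties as ℤ
  open import Data.Integer.Tactic.RingSolver using (solve-∀)
  open import Algebra.Properties.CommutativeMonoid.Sum ℤ.+-0-commutativeMonoid using (sum; ∑-distrib-+)
  open import Data.Sum using (_⊎_; inj₁; inj₂)
  open import Function using (id; _∘_)
  open import Relation.Nullary using (¬_; yes; no; contradiction)
  open import Relation.Binary.PropositionalEquality using (_≡_; refl; sym; trans; cong; cong₂; subst)

  Σ : ∀ {R : Set} {k} → (R → ℤ) → Vec R k → ℤ
  Σ φ xs = sum (λ i → φ (lookup xs i))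

  Σ-+ : ∀ {R : Set} {k} (f g : R → ℤ) (xs : Vec R k) → Σ (λ x → f x + g x) xs ≡ Σ f xs + Σ g xs
  Σ-+ f g xs = ∑-distrib-+ (f ∘ lookup xs) (g ∘ lookup xs)

  data Kind : Set where
    up down flat : Kind

  opposite : Kind → Kind
  opposite up = down
  opposite down = up
  opposite flat = flat

  opposite-involutive : ∀ κ → opposite (opposite κ) ≡ κ
  opposite-involutive up = refl
  opposite-involutive down = refl
  opposite-involutive flat = refl

  weight : Kind → ℤ
  weight up = 1ℤ
  weight down = -1ℤ
  weight flat = 0ℤ

  weight-opposite : ∀ κ → weight (opposite κ) ≡ - weight κ
  weight-opposite up = refl
  weight-opposite down = refl
  weight-opposite flat = refl

  weight≤1 : ∀ κ → weight κ ≤ 1ℤ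
  weight≤1 up = ℤ.≤-refl
  weight≤1 down = -≤+
  weight≤1 flat = +≤+ z≤n

  σ : ∀ {k} → Vec Kind k → ℤ
  σ = Σ weight

  -- the largest sum of a final segment, the empty one included
  μ : ∀ {k} → Vec Kind k → ℤ
  μ [] = 0ℤ
  μ (κ ∷ κs) = μ κs ⊔ σ (κ ∷ κs)

  σ≤μ : ∀ {k} (κs : Vec Kind k) → σ κs ≤ μ κs
  σ≤μ [] = ℤ.≤-refl
  σ≤μ (κ ∷ κs) = ℤ.i≤j⊔i _ _

  module Flip {R : Set} (s : R → R) where

    flipIf : Bool → R → R
    flipIf true = s
    flipIf false = id

    flipAt : ∀ {k} → Vec Bool k → Vec R k → Vec R k
    flipAt = zipWith flipIf

    lookup-flipAt : ∀ {k} i (bs : Vec Bool k) xs → lookup (flipAt bs xs) i ≡ flipIf (lookup bs i) (lookup xs i)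
    lookup-flipAt = lookup-zipWith flipIf

    flipAt-involutive : (∀ x → s (s x) ≡ x) → ∀ {k} (bs : Vec Bool k) xs → flipAt bs (flipAt bs xs) ≡ xs
    flipAt-involutive s² [] [] = refl
    flipAt-involutive s² (true ∷ bs) (x ∷ xs) = cong₂ _∷_ (s² x) (flipAt-involutive s² bs xs)
    flipAt-involutive s² (false ∷ bs) (x ∷ xs) = cong (x ∷_) (flipAt-involutive s² bs xs)

  open Flip opposite using () renaming (flipAt to flipKinds)

  δ : ∀ {k} → Vec Bool k → Vec Kind k → ℤ
  δ [] [] = 0ℤ
  δ (true ∷ bs) (κ ∷ κs) = weight κ + δ bs κs
  δ (false ∷ bs) (κ ∷ κs) = δ bs κs

  module _ {R : Set} (s : R → R) (kind : R → Kind) where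
    open Flip s

    map-kind-flipAt : (∀ x → kind (s x) ≡ opposite (kind x)) →
      ∀ {k} (bs : Vec Bool k) xs → map kind (flipAt bs xs) ≡ flipKinds bs (map kind xs)
    map-kind-flipAt kind-s [] [] = refl
    map-kind-flipAt kind-s (true ∷ bs) (x ∷ xs) = cong₂ _∷_ (kind-s x) (map-kind-flipAt kind-s bs xs)
    map-kind-flipAt kind-s (false ∷ bs) (x ∷ xs) = cong (kind x ∷_) (map-kind-flipAt kind-s bs xs)

    Σ-flipAt : (φ : R → ℤ) (c : ℤ) → (∀ x → φ (s x) ≡ φ x + c * weight (kind x)) →
      ∀ {k} (bs : Vec Bool k) xs → Σ φ (flipAt bs xs) ≡ Σ φ xs + c * δ bs (map kind xs)
    Σ-flipAt φ c φ-s [] [] = sym (cong (_+_ 0ℤ) (ℤ.*-zeroʳ c))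
    Σ-flipAt φ c φ-s (true ∷ bs) (x ∷ xs) =
      trans (cong₂ _+_ (φ-s x) (Σ-flipAt φ c φ-s bs xs)) (regroup (φ x) (Σ φ xs) c (weight (kind x)) _)
      where
      regroup : ∀ a b c w d → (a + c * w) + (b + c * d) ≡ (a + b) + c * (w + d)
      regroup = solve-∀
    Σ-flipAt φ c φ-s (false ∷ bs) (x ∷ xs) =
      trans (cong (_+_ (φ x)) (Σ-flipAt φ c φ-s bs xs)) (sym (ℤ.+-assoc (φ x) (Σ φ xs) _))

  σ-opposite : ∀ {k} (κs : Vec Kind k) → σ (map opposite κs) ≡ - σ κs
  σ-opposite [] = refl
  σ-opposite (κ ∷ κs) =
    trans (cong₂ _+_ (weight-opposite κ) (σ-opposite κs)) (sym (ℤ.neg-distrib-+ (weight κ) (σ κs)))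

  δ-opposite : ∀ {k} (bs : Vec Bool k) κs → δ bs (map opposite κs) ≡ - δ bs κs
  δ-opposite [] [] = refl
  δ-opposite (true ∷ bs) (κ ∷ κs) =
    trans (cong₂ _+_ (weight-opposite κ) (δ-opposite bs κs)) (sym (ℤ.neg-distrib-+ (weight κ) (δ bs κs)))
  δ-opposite (false ∷ bs) (κ ∷ κs) = δ-opposite bs κs

  δ-all : ∀ {k} (κs : Vec Kind k) → δ (replicate _ true) κs ≡ σ κs
  δ-all [] = refl
  δ-all (κ ∷ κs) = cong (_+_ (weight κ)) (δ-all κs)

  map-opposite-flipAll : ∀ {k} (κs : Vec Kind k) → map opposite (flipKinds (replicate _ true) κs) ≡ κs
  map-opposite-flipAll [] = refl
  map-opposite-flipAll (κ ∷ κs) = cong₂ _∷_ (opposite-involutive κ) (map-opposite-flipAll κs)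

  ≰1⇒≤0 : ∀ {i} → ¬ (1ℤ ≤ i) → i ≤ 0ℤ
  ≰1⇒≤0 {+ zero} _ = ℤ.≤-refl
  ≰1⇒≤0 {+ suc n} 1≰i = contradiction (+≤+ (s≤s z≤n)) 1≰i
  ≰1⇒≤0 {Data.Integer.-[1+ n ]} _ = -≤+

  1≤⊔⇒1≤ʳ : ∀ {i j} → ¬ (1ℤ ≤ i) → 1ℤ ≤ i ⊔ j → 1ℤ ≤ j
  1≤⊔⇒1≤ʳ {i} {j} 1≰i 1≤i⊔j with ℤ.⊔-sel i j
  ... | inj₁ i⊔j≡i = contradiction (subst (1ℤ ≤_) i⊔j≡i 1≤i⊔j) 1≰i
  ... | inj₂ i⊔j≡j = subst (1ℤ ≤_) i⊔j≡j 1≤i⊔j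

  -- flags the shortest final segment of positive sum, whose sum is then 1
  reflectFlags : ∀ {k} → Vec Kind k → Vec Bool k
  reflectFlags [] = []
  reflectFlags (κ ∷ κs) with 1ℤ ≤? μ κs
  ... | yes _ = false ∷ reflectFlags κs
  ... | no _ = replicate _ true

  reflectFlags-no : ∀ {k} κ (κs : Vec Kind k) → ¬ (1ℤ ≤ μ κs) → reflectFlags (κ ∷ κs) ≡ replicate _ true
  reflectFlags-no κ κs 1≰μ with 1ℤ ≤? μ κs
  ... | yes 1≤μ = contradiction 1≤μ 1≰μ
  ... | no _ = refl

  δ-reflectFlags : ∀ {k} (κs : Vec Kind k) → 1ℤ ≤ μ κs → δ (reflectFlags κs) κs ≡ 1ℤ
  δ-reflectFlags [] (+≤+ ())
  δ-reflectFlags (κ ∷ κs) 1≤μ with 1ℤ ≤? μ κs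
  ... | yes 1≤μκs = δ-reflectFlags κs 1≤μκs
  ... | no 1≰μκs = trans (δ-all (κ ∷ κs)) (ℤ.≤-antisym σ≤1 (1≤⊔⇒1≤ʳ 1≰μκs 1≤μ))
    where
    σ≤1 : σ (κ ∷ κs) ≤ 1ℤ
    σ≤1 = ℤ.+-mono-≤ (weight≤1 κ) (ℤ.≤-trans (σ≤μ κs) (≰1⇒≤0 1≰μκs))

  -- the kinds after reflecting, as seen by the reflection with opposite weights
  reflected⁻ : ∀ {k} → Vec Kind k → Vec Kind k
  reflected⁻ κs = map opposite (flipKinds (reflectFlags κs) κs)

  1≤μ-reflected⁻ : ∀ {k} (κs : Vec Kind k) → 1ℤ ≤ μ κs → 1ℤ ≤ μ (reflected⁻ κs)
  1≤μ-reflected⁻ [] (+≤+ ())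
  1≤μ-reflected⁻ (κ ∷ κs) 1≤μ with 1ℤ ≤? μ κs
  ... | yes 1≤μκs = ℤ.≤-trans (1≤μ-reflected⁻ κs 1≤μκs) (ℤ.i≤i⊔j _ _)
  ... | no _ = subst (λ κs′ → 1ℤ ≤ μ κs′) (sym (map-opposite-flipAll (κ ∷ κs))) 1≤μ

  reflectFlags-reflected⁻ : ∀ {k} (κs : Vec Kind k) → 1ℤ ≤ μ κs →
    reflectFlags (reflected⁻ κs) ≡ reflectFlags κs
  reflectFlags-reflected⁻ [] (+≤+ ())
  reflectFlags-reflected⁻ (κ ∷ κs) 1≤μ with 1ℤ ≤? μ κs
  ... | no 1≰μκs = trans (cong reflectFlags (map-opposite-flipAll (κ ∷ κs))) (reflectFlags-no κ κs 1≰μκs)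
  ... | yes 1≤μκs with 1ℤ ≤? μ (reflected⁻ κs)
  ...   | yes _ = cong (false ∷_) (reflectFlags-reflected⁻ κs 1≤μκs)
  ...   | no 1≰μ′ = contradiction (1≤μ-reflected⁻ κs 1≤μκs) 1≰μ′

  ups : ∀ {k} → Vec Kind k → ℕ
  ups [] = 0
  ups (up ∷ κs) = suc (ups κs)
  ups (down ∷ κs) = ups κs
  ups (flat ∷ κs) = ups κs

  -- flags what makes the first m non-flat entries up and all later ones down
  arrangeFlags : ∀ {k} → ℕ → Vec Kind k → Vec Bool k
  arrangeFlags m [] = []
  arrangeFlags m (flat ∷ κs) = false ∷ arrangeFlags m κs
  arrangeFlags zero (up ∷ κs) = true ∷ arrangeFlags zero κs
  arrangeFlags (suc m) (up ∷ κs) = false ∷ arrangeFlags m κs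
  arrangeFlags zero (down ∷ κs) = false ∷ arrangeFlags zero κs
  arrangeFlags (suc m) (down ∷ κs) = true ∷ arrangeFlags m κs

  δ-arrangeFlags : ∀ {k} m (κs : Vec Kind k) → m ℕ.≤ ups κs → δ (arrangeFlags m κs) κs + + m ≡ + ups κs
  δ-arrangeFlags zero [] z≤n = refl
  δ-arrangeFlags m (flat ∷ κs) m≤ = δ-arrangeFlags m κs m≤
  δ-arrangeFlags zero (up ∷ κs) _ =
    trans (ℤ.+-assoc 1ℤ (δ (arrangeFlags zero κs) κs) (+ 0))
          (trans (cong (_+_ 1ℤ) (δ-arrangeFlags zero κs z≤n)) (sym (ℤ.pos-+ 1 (ups κs))))
  δ-arrangeFlags (suc m) (up ∷ κs) (s≤s m≤) =
    trans (swap-1 (δ (arrangeFlags m κs) κs) (+ m))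
          (trans (cong (_+_ 1ℤ) (δ-arrangeFlags m κs m≤)) (sym (ℤ.pos-+ 1 (ups κs))))
    where
    swap-1 : ∀ d m → d + (1ℤ + m) ≡ 1ℤ + (d + m)
    swap-1 = solve-∀
  δ-arrangeFlags zero (down ∷ κs) m≤ = δ-arrangeFlags zero κs m≤
  δ-arrangeFlags (suc m) (down ∷ κs) m<ups =
    trans (cancel (δ (arrangeFlags m κs) κs) (+ m)) (δ-arrangeFlags m κs (ℕ.<⇒≤ m<ups))
    where
    cancel : ∀ d m → (-1ℤ + d) + (1ℤ + m) ≡ d + m
    cancel = solve-∀

  arrangeWith : ∀ {k} → ℕ → Vec Kind k → Vec Kind k
  arrangeWith m κs = flipKinds (arrangeFlags m κs) κs

  arranged : ∀ {k} → Vec Kind k → Vec Kind k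
  arranged κs = arrangeWith (ups κs) κs

  -2ℤ : ℤ
  -2ℤ = - (+ 2)

  σ-flipKinds : ∀ {k} (bs : Vec Bool k) κs → σ (flipKinds bs κs) ≡ σ κs + -2ℤ * δ bs κs
  σ-flipKinds bs κs =
    trans (Σ-flipAt opposite id weight -2ℤ weight-opposite′ bs κs)
          (cong (λ κs′ → σ κs + -2ℤ * δ bs κs′) (map-id κs))
    where
    weight-opposite′ : ∀ κ → weight (opposite κ) ≡ weight κ + -2ℤ * weight κ
    weight-opposite′ up = refl
    weight-opposite′ down = refl
    weight-opposite′ flat = refl

  δ-arranged : ∀ {k} (κs : Vec Kind k) → δ (arrangeFlags (ups κs) κs) κs ≡ 0ℤ
  δ-arranged κs = trans (add-sub _ (+ ups κs))
    (trans (cong (_- + ups κs) (δ-arrangeFlags (ups κs) κs ℕ.≤-refl)) (ℤ.+-inverseʳ (+ ups κs)))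
    where
    add-sub : ∀ d u → d ≡ (d + u) - u
    add-sub = solve-∀

  σ-arranged : ∀ {k} (κs : Vec Kind k) → σ (arranged κs) ≡ σ κs
  σ-arranged κs = trans (σ-flipKinds (arrangeFlags (ups κs) κs) κs)
    (trans (cong (λ d → σ κs + -2ℤ * d) (δ-arranged κs)) (ℤ.+-identityʳ (σ κs)))

  μ-cons≤ : ∀ {k} κ (κs : Vec Kind k) → 0ℤ ≤ weight κ ⊎ σ κs ≤ 0ℤ →
    μ κs ≤ 0ℤ ⊔ σ κs → μ (κ ∷ κs) ≤ 0ℤ ⊔ σ (κ ∷ κs)
  μ-cons≤ κ κs (inj₁ 0≤w) μ≤ = ℤ.⊔-lub
    (ℤ.≤-trans μ≤ (ℤ.⊔-monoʳ-≤ 0ℤ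
      (subst (_≤ σ (κ ∷ κs)) (ℤ.+-identityˡ (σ κs)) (ℤ.+-monoˡ-≤ (σ κs) 0≤w))))
    (ℤ.i≤j⊔i _ _)
  μ-cons≤ κ κs (inj₂ σ≤0) μ≤ =
    ℤ.⊔-lub (ℤ.≤-trans μ≤ (ℤ.≤-trans (ℤ.⊔-lub ℤ.≤-refl σ≤0) (ℤ.i≤i⊔j _ _))) (ℤ.i≤j⊔i _ _)

  σ-arrangeWith-zero : ∀ {k} (κs : Vec Kind k) → σ (arrangeWith zero κs) ≤ 0ℤ
  σ-arrangeWith-zero [] = ℤ.≤-refl
  σ-arrangeWith-zero (flat ∷ κs) = ℤ.+-mono-≤ (ℤ.≤-refl {0ℤ}) (σ-arrangeWith-zero κs)
  σ-arrangeWith-zero (up ∷ κs) = ℤ.+-mono-≤ -≤+ (σ-arrangeWith-zero κs)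
  σ-arrangeWith-zero (down ∷ κs) = ℤ.+-mono-≤ -≤+ (σ-arrangeWith-zero κs)

  μ-arrangeWith : ∀ {k} m (κs : Vec Kind k) → μ (arrangeWith m κs) ≤ 0ℤ ⊔ σ (arrangeWith m κs)
  μ-arrangeWith m [] = ℤ.≤-refl
  μ-arrangeWith m (flat ∷ κs) = μ-cons≤ flat (arrangeWith m κs) (inj₁ ℤ.≤-refl) (μ-arrangeWith m κs)
  μ-arrangeWith zero (up ∷ κs) =
    μ-cons≤ down (arrangeWith zero κs) (inj₂ (σ-arrangeWith-zero κs)) (μ-arrangeWith zero κs)
  μ-arrangeWith (suc m) (up ∷ κs) = μ-cons≤ up (arrangeWith m κs) (inj₁ (+≤+ z≤n)) (μ-arrangeWith m κs)
  μ-arrangeWith zero (down ∷ κs) =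
    μ-cons≤ down (arrangeWith zero κs) (inj₂ (σ-arrangeWith-zero κs)) (μ-arrangeWith zero κs)
  μ-arrangeWith (suc m) (down ∷ κs) = μ-cons≤ up (arrangeWith m κs) (inj₁ (+≤+ z≤n)) (μ-arrangeWith m κs)

  μ-arranged : ∀ {k} (κs : Vec Kind k) → σ κs ≤ 0ℤ → μ (arranged κs) ≤ 0ℤ
  μ-arranged κs σ≤0 =
    ℤ.≤-trans (μ-arrangeWith (ups κs) κs) (ℤ.⊔-lub ℤ.≤-refl (subst (_≤ 0ℤ) (sym (σ-arranged κs)) σ≤0))

  module Rows {R : Set} (s : R → R) (s-involutive : ∀ x → s (s x) ≡ x)
              (kind : R → Kind) (kind-s : ∀ x → kind (s x) ≡ opposite (kind x)) where

    open Flip s public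

    kinds : ∀ {k} → Vec R k → Vec Kind k
    kinds = map kind

    kinds⁻ : ∀ {k} → Vec R k → Vec Kind k
    kinds⁻ xs = map opposite (kinds xs)

    reflect reflect⁻ arrange : ∀ {k} → Vec R k → Vec R k
    reflect xs = flipAt (reflectFlags (kinds xs)) xs
    reflect⁻ xs = flipAt (reflectFlags (kinds⁻ xs)) xs
    arrange xs = flipAt (arrangeFlags (ups (kinds⁻ xs)) (kinds⁻ xs)) xs

    kinds⁻-reflect : ∀ {k} (xs : Vec R k) → kinds⁻ (reflect xs) ≡ reflected⁻ (kinds xs)
    kinds⁻-reflect xs = cong (map opposite) (map-kind-flipAt s kind kind-s (reflectFlags (kinds xs)) xs)

    reflect⁻-reflect : ∀ {k} (xs : Vec R k) → 1ℤ ≤ μ (kinds xs) → reflect⁻ (reflect xs) ≡ xs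
    reflect⁻-reflect xs 1≤μ =
      trans (cong (λ bs → flipAt bs (reflect xs))
                  (trans (cong reflectFlags (kinds⁻-reflect xs)) (reflectFlags-reflected⁻ (kinds xs) 1≤μ)))
            (flipAt-involutive s-involutive (reflectFlags (kinds xs)) xs)

    1≤μ-reflect : ∀ {k} (xs : Vec R k) → 1ℤ ≤ μ (kinds xs) → 1ℤ ≤ μ (kinds⁻ (reflect xs))
    1≤μ-reflect xs 1≤μ =
      subst (λ κs → 1ℤ ≤ μ κs) (sym (kinds⁻-reflect xs)) (1≤μ-reflected⁻ (kinds xs) 1≤μ)

    module _ (φ : R → ℤ) (c : ℤ) (φ-s : ∀ x → φ (s x) ≡ φ x + c * weight (kind x)) where

      Σ-reflect : ∀ {k} (xs : Vec R k) → 1ℤ ≤ μ (kinds xs) → Σ φ (reflect xs) ≡ Σ φ xs + c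
      Σ-reflect xs 1≤μ = trans (Σ-flipAt s kind φ c φ-s (reflectFlags (kinds xs)) xs)
        (trans (cong (λ d → Σ φ xs + c * d) (δ-reflectFlags (kinds xs) 1≤μ))
               (cong (_+_ (Σ φ xs)) (ℤ.*-identityʳ c)))

      Σ-arrange : ∀ {k} (xs : Vec R k) → Σ φ (arrange xs) ≡ Σ φ xs
      Σ-arrange xs = trans (Σ-flipAt s kind φ c φ-s bs xs)
        (trans (cong (λ d → Σ φ xs + c * d) δ≡0)
               (trans (cong (_+_ (Σ φ xs)) (ℤ.*-zeroʳ c)) (ℤ.+-identityʳ (Σ φ xs))))
        where
        bs = arrangeFlags (ups (kinds⁻ xs)) (kinds⁻ xs)
        δ≡0 : δ bs (kinds xs) ≡ 0ℤ
        δ≡0 = trans (sym (ℤ.neg-involutive _))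
                    (trans (cong -_ (sym (δ-opposite bs (kinds xs)))) (cong -_ (δ-arranged (kinds⁻ xs))))

    μ-arrange : ∀ {k} (xs : Vec R k) → 0ℤ ≤ σ (kinds xs) → μ (kinds⁻ (arrange xs)) ≤ 0ℤ
    μ-arrange xs 0≤σ = subst (λ κs → μ κs ≤ 0ℤ) (sym kinds⁻-arrange)
      (μ-arranged (kinds⁻ xs) (subst (_≤ 0ℤ) (sym (σ-opposite (kinds xs))) (ℤ.neg-mono-≤ 0≤σ)))
      where
      bs = arrangeFlags (ups (kinds⁻ xs)) (kinds⁻ xs)
      kinds⁻-arrange : kinds⁻ (arrange xs) ≡ arranged (kinds⁻ xs)
      kinds⁻-arrange = trans (cong (map opposite) (map-kind-flipAt s kind kind-s bs xs))
                             (map-kind-flipAt opposite opposite (λ _ → refl) bs (kinds xs))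

module Realizations where

  open Sums
  open import Data.Nat using (ℕ)
  open import Data.Bool using (Bool)
  open import Data.Fin using (Fin)
  open import Data.Vec using (Vec; lookup; map)
  open import Data.Vec.Properties using (lookup-map)
  open import Data.Integer using (ℤ; +_)
  import Data.Integer.Properties as ℤ
  open import Algebra.Properties.CommutativeMonoid.Sum ℤ.+-0-commutativeMonoid using (sum; sum-cong-≗)
  open import Data.Product using (_×_; _,_; ∃₂)
  open import Data.Sum using (_⊎_; inj₁; inj₂)
  open import Relation.Binary.PropositionalEquality using (_≡_; _≢_; sym; trans; cong)

  arc : ∀ {n} → Adj n → Fin n → Fin n → Bool
  arc M i j = lookup (lookup M i) j

  colSum : ∀ {n} → Adj n → Fin n → ℤ
  colSum M j = sum (λ i → ⟦ arc M i j ⟧)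

  indeg≡colSum : ∀ {n} (M : Adj n) j → + indeg M j ≡ colSum M j
  indeg≡colSum M j = trans (bsum≡sum (map (λ row → lookup row j) M))
    (sum-cong-≗ λ i → cong ⟦_⟧ (lookup-map i (λ row → lookup row j) M))

  colSum-realization : ∀ {n} {a b : Vec ℕ n} {M} → IsRealization a b M → ∀ j → colSum M j ≡ + lookup a j
  colSum-realization {M = M} (_ , indeg≡a , _) j = trans (sym (indeg≡colSum M j)) (cong +_ (indeg≡a j))

  RowsTransposed : ∀ {n} → Adj n → Adj n → Set
  RowsTransposed M M′ =
    ∀ i → lookup M′ i ≡ lookup M i ⊎ ∃₂ λ x y → i ≢ x × i ≢ y × lookup M′ i ≡ swapCols x y (lookup M i)

  RowsTransposed-realization : ∀ {n} {a a′ b : Vec ℕ n} (M M′ : Adj n) → RowsTransposed M M′ →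
    IsRealization a b M → (∀ c → colSum M′ c ≡ + lookup a′ c) → IsRealization a′ b M′
  RowsTransposed-realization M M′ transposed (loopless , _ , outdeg≡b) colSum≡a′ =
    loopless′ ,
    (λ c → ℤ.+-injective (trans (indeg≡colSum M′ c) (colSum≡a′ c))) ,
    (λ i → trans (outdeg′ i) (outdeg≡b i))
    where
    loopless′ : Loopless M′
    loopless′ i with transposed i
    ... | inj₁ eq rewrite eq = loopless i
    ... | inj₂ (x , y , i≢x , i≢y , eq) rewrite eq = trans (lookup-swapCols-other x y (lookup M i) i≢x i≢y) (loopless i)
    outdeg′ : ∀ i → outdeg M′ i ≡ outdeg M i
    outdeg′ i with transposed i
    ... | inj₁ eq = cong bsum eq
    ... | inj₂ (x , y , _ , _ , eq) = trans (cong bsum eq) (bsum-swapCols x y (lookup M i))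

module IndegreeTransfer where

  open Counting
  open Sums
  open Reflection
  open Realizations
  open import Data.Nat as ℕ using (ℕ; suc; z≤n; s≤s)
  import Data.Nat.Properties as ℕ
  open import Data.Bool using (Bool; true; false)
  open import Data.Fin using (Fin; _≟_)
  open import Data.Vec using (Vec; lookup; map; tabulate; zip)
  open import Data.Vec.Properties
    using (lookup-map; lookup-zip; lookup∘tabulate; map-proj₁-zip; map-proj₂-zip; map-<,>-zip; map-id)
  open import Data.Integer using (ℤ; +_; -_; _+_; _-_; _*_; 0ℤ; 1ℤ; -1ℤ; _≤_; +≤+; -≤+)
  import Data.Integer.Properties as ℤ
  open import Data.Integer.Tactic.RingSolver using (solve-∀)
  open import Algebra.Properties.CommutativeMonoid.Sum ℤ.+-0-commutativeMonoid using (sum; sum-cong-≗)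
  open import Data.Product using (_×_; _,_; proj₁; proj₂; <_,_>; ∃₂)
  open import Data.Sum using (_⊎_; inj₁; inj₂; [_,_])
  open import Function using (_∘_)
  open import Relation.Nullary using (yes; no; contradiction)
  open import Relation.Binary.PropositionalEquality
    using (_≡_; _≢_; refl; sym; trans; cong; cong₂; subst; module ≡-Reasoning)

  summand-lower-bound : ∀ s i k d {x y} → x ≡ y + (s + i) → y + k ≤ x → i ≤ d → k - d ≤ s
  summand-lower-bound s i k d {x} {y} x≡ k≤ i≤d = begin
    k - d                 ≡⟨ shuffle₁ y k d ⟩
    (y + k) + - (y + d)   ≤⟨ ℤ.+-monoˡ-≤ (- (y + d)) k≤ ⟩
    x + - (y + d)         ≡⟨ trans (cong (_+ - (y + d)) x≡) (shuffle₂ y s i d) ⟩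
    s + (i - d)           ≤⟨ ℤ.+-monoʳ-≤ s (ℤ.i≤j⇒i-j≤0 i≤d) ⟩
    s + 0ℤ                ≡⟨ ℤ.+-identityʳ s ⟩
    s                     ∎
    where
    open ℤ.≤-Reasoning
    shuffle₁ : ∀ y k d → k - d ≡ (y + k) + - (y + d)
    shuffle₁ = solve-∀
    shuffle₂ : ∀ y s i d → (y + (s + i)) + - (y + d) ≡ s + (i - d)
    shuffle₂ = solve-∀

  suc-pred : ∀ i → (1ℤ + i) + -1ℤ ≡ i
  suc-pred = solve-∀

  module ColumnTransfer {n} {p q : Fin n} (p≢q : p ≢ q) where

    -- rows p and q stay fixed, so that exchanging columns p and q never creates a loop
    isActive : Fin n → Bool
    isActive i with i ≟ p | i ≟ q
    ... | yes _ | _ = false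
    ... | no _ | yes _ = false
    ... | no _ | no _ = true

    isActive⇒≢ : ∀ i → isActive i ≡ true → i ≢ p × i ≢ q
    isActive⇒≢ i active with i ≟ p | i ≟ q
    isActive⇒≢ i () | yes _ | _
    isActive⇒≢ i () | no _ | yes _
    ... | no i≢p | no i≢q = i≢p , i≢q

    isActive-p : isActive p ≡ false
    isActive-p with p ≟ p
    ... | yes _ = refl
    ... | no p≢p = contradiction refl p≢p

    isActive-q : isActive q ≡ false
    isActive-q with q ≟ p | q ≟ q
    ... | yes _ | _ = refl
    ... | no _ | yes _ = refl
    ... | no _ | no q≢q = contradiction refl q≢q

    isActive-other : ∀ {i} → i ≢ p → i ≢ q → isActive i ≡ true
    isActive-other {i} i≢p i≢q with i ≟ p | i ≟ q
    ... | yes i≡p | _ = contradiction i≡p i≢p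
    ... | no _ | yes i≡q = contradiction i≡q i≢q
    ... | no _ | no _ = refl

    Row : Set
    Row = Bool × Vec Bool n

    swapRow : Row → Row
    swapRow (true , r) = true , swapCols p q r
    swapRow (false , r) = false , r

    kindOf : Bool → Bool → Kind
    kindOf true false = up
    kindOf false true = down
    kindOf true true = flat
    kindOf false false = flat

    kind : Row → Kind
    kind (true , r) = kindOf (lookup r p) (lookup r q)
    kind (false , r) = flat

    swapRow-involutive : ∀ x → swapRow (swapRow x) ≡ x
    swapRow-involutive (true , r) = cong (true ,_) (swapCols-involutive p q r)
    swapRow-involutive (false , r) = refl

    kind-swapRow : ∀ x → kind (swapRow x) ≡ opposite (kind x)
    kind-swapRow (false , r) = refl
    kind-swapRow (true , r) rewrite lookup-swapColsˡ p q r | lookup-swapColsʳ p q r with lookup r p | lookup r q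
    ... | true | true = refl
    ... | true | false = refl
    ... | false | true = refl
    ... | false | false = refl

    open Rows swapRow swapRow-involutive kind kind-swapRow

    rowsOf : Adj n → Vec Row n
    rowsOf M = zip (tabulate isActive) M

    matrix : ∀ {k} → Vec Row k → Vec (Vec Bool n) k
    matrix = map proj₂

    lookup-rowsOf : ∀ M i → lookup (rowsOf M) i ≡ (isActive i , lookup M i)
    lookup-rowsOf M i = trans (lookup-zip i (tabulate isActive) M) (cong (_, lookup M i) (lookup∘tabulate isActive i))

    rowsOf-matrix-flipAt : ∀ bs M → rowsOf (matrix (flipAt bs (rowsOf M))) ≡ flipAt bs (rowsOf M)
    rowsOf-matrix-flipAt bs M = begin
      zip (tabulate isActive) (map proj₂ X)      ≡⟨ cong (λ as → zip as (map proj₂ X)) (sym flags-kept) ⟩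
      zip (map proj₁ X) (map proj₂ X)            ≡⟨ map-<,>-zip proj₁ proj₂ X ⟨
      map < proj₁ , proj₂ > X                    ≡⟨ map-id X ⟩
      X                                          ∎
      where
      open ≡-Reasoning
      X = flipAt bs (rowsOf M)
      proj₁-flipIf : ∀ b x → proj₁ (flipIf b x) ≡ proj₁ x
      proj₁-flipIf false x = refl
      proj₁-flipIf true (true , r) = refl
      proj₁-flipIf true (false , r) = refl
      flags-kept : map proj₁ X ≡ tabulate isActive
      flags-kept = trans (lookup-ext λ i → trans (lookup-map i proj₁ X) (trans (cong proj₁ (lookup-flipAt i bs (rowsOf M)))
                     (trans (proj₁-flipIf (lookup bs i) _) (sym (lookup-map i proj₁ (rowsOf M))))))
                   (map-proj₁-zip (tabulate isActive) M)

    matrix-flipAt-transposed : ∀ bs M → RowsTransposed M (matrix (flipAt bs (rowsOf M)))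
    matrix-flipAt-transposed bs M i
      rewrite lookup-map i proj₂ (flipAt bs (rowsOf M)) | lookup-flipAt i bs (rowsOf M) | lookup-rowsOf M i
      = cases (lookup bs i) (isActive i) refl
      where
      cases : ∀ b a → isActive i ≡ a →
        proj₂ (flipIf b (a , lookup M i)) ≡ lookup M i ⊎
        ∃₂ λ x y → i ≢ x × i ≢ y × proj₂ (flipIf b (a , lookup M i)) ≡ swapCols x y (lookup M i)
      cases false a _ = inj₁ refl
      cases true false _ = inj₁ refl
      cases true true active = let i≢p , i≢q = isActive⇒≢ i active in inj₂ (p , q , i≢p , i≢q , refl)

    entry : Fin n → Row → ℤ
    entry c (_ , r) = ⟦ lookup r c ⟧

    colSum-matrix : ∀ X c → colSum (matrix X) c ≡ Σ (entry c) X
    colSum-matrix X c = sum-cong-≗ λ i → cong (λ r → ⟦ lookup r c ⟧) (lookup-map i proj₂ X)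

    colSum-rowsOf : ∀ M c → colSum M c ≡ Σ (entry c) (rowsOf M)
    colSum-rowsOf M c = trans (cong (λ M′ → colSum M′ c) (sym (map-proj₂-zip (tabulate isActive) M)))
                              (colSum-matrix (rowsOf M) c)

    entry-p-swapRow : ∀ x → entry p (swapRow x) ≡ entry p x + -1ℤ * weight (kind x)
    entry-p-swapRow (false , r) = sym (ℤ.+-identityʳ _)
    entry-p-swapRow (true , r) rewrite lookup-swapColsˡ p q r with lookup r p | lookup r q
    ... | true | true = refl
    ... | true | false = refl
    ... | false | true = refl
    ... | false | false = refl

    entry-q-swapRow : ∀ x → entry q (swapRow x) ≡ entry q x + 1ℤ * weight (kind x)
    entry-q-swapRow (false , r) = sym (ℤ.+-identityʳ _)
    entry-q-swapRow (true , r) rewrite lookup-swapColsʳ p q r with lookup r p | lookup r q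
    ... | true | true = refl
    ... | true | false = refl
    ... | false | true = refl
    ... | false | false = refl

    entry-other-swapRow : ∀ {c} → c ≢ p → c ≢ q → ∀ x → entry c (swapRow x) ≡ entry c x + 0ℤ * weight (kind x)
    entry-other-swapRow c≢p c≢q (false , r) = sym (ℤ.+-identityʳ _)
    entry-other-swapRow c≢p c≢q (true , r) =
      trans (cong ⟦_⟧ (lookup-swapCols-other p q r c≢p c≢q)) (sym (ℤ.+-identityʳ _))

    -- the contribution of the fixed rows p and q to colSum p - colSum q
    ι : Adj n → ℤ
    ι M = ⟦ arc M q p ⟧ - ⟦ arc M p q ⟧

    column-difference : ∀ M → Loopless M → colSum M p ≡ colSum M q + (σ (kinds (rowsOf M)) + ι M)
    column-difference M loopless = begin
      colSum M p
        ≡⟨ colSum-rowsOf M p ⟩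
      Σ (entry p) X
        ≡⟨ sum-cong-≗ (entry-p ∘ lookup X) ⟩
      Σ (λ x → entry q x + (weight (kind x) + fixed x)) X
        ≡⟨ Σ-+ (entry q) (λ x → weight (kind x) + fixed x) X ⟩
      Σ (entry q) X + Σ (λ x → weight (kind x) + fixed x) X
        ≡⟨ cong (_+_ (Σ (entry q) X)) (Σ-+ (weight ∘ kind) fixed X) ⟩
      Σ (entry q) X + (Σ (weight ∘ kind) X + Σ fixed X)
        ≡⟨ cong₂ (λ a b → a + (b + Σ fixed X)) (sym (colSum-rowsOf M q)) σ≡ ⟩
      colSum M q + (σ (kinds X) + Σ fixed X)
        ≡⟨ cong (λ t → colSum M q + (σ (kinds X) + t)) fixed≡ι ⟩
      colSum M q + (σ (kinds X) + ι M)
        ∎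
      where
      open ≡-Reasoning
      X = rowsOf M
      fixed : Row → ℤ
      fixed (true , r) = 0ℤ
      fixed (false , r) = ⟦ lookup r p ⟧ - ⟦ lookup r q ⟧
      entry-p : ∀ x → entry p x ≡ entry q x + (weight (kind x) + fixed x)
      entry-p (true , r) with lookup r p | lookup r q
      ... | true | true = refl
      ... | true | false = refl
      ... | false | true = refl
      ... | false | false = refl
      entry-p (false , r) with lookup r p | lookup r q
      ... | true | true = refl
      ... | true | false = refl
      ... | false | true = refl
      ... | false | false = refl
      σ≡ : Σ (weight ∘ kind) X ≡ σ (kinds X)
      σ≡ = sum-cong-≗ λ i → cong weight (sym (lookup-map i kind X))
      fixed-at : ∀ i → fixed (lookup X i) ≡ fixed (isActive i , lookup M i)
      fixed-at i = cong fixed (lookup-rowsOf M i)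
      fixed≡ι : Σ fixed X ≡ ι M
      fixed≡ι = begin
        Σ fixed X
          ≡⟨ sum-pair p≢q (fixed ∘ lookup X) (λ i i≢p i≢q →
               trans (fixed-at i) (cong (λ a → fixed (a , lookup M i)) (isActive-other i≢p i≢q))) ⟩
        fixed (lookup X p) + fixed (lookup X q)
          ≡⟨ cong₂ _+_ (trans (fixed-at p) (cong (λ a → fixed (a , lookup M p)) isActive-p))
                       (trans (fixed-at q) (cong (λ a → fixed (a , lookup M q)) isActive-q)) ⟩
        (⟦ arc M p p ⟧ - ⟦ arc M p q ⟧) + (⟦ arc M q p ⟧ - ⟦ arc M q q ⟧)
          ≡⟨ cong₂ (λ a b → (⟦ a ⟧ - ⟦ arc M p q ⟧) + (⟦ arc M q p ⟧ - ⟦ b ⟧)) (loopless p) (loopless q) ⟩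
        (0ℤ - ⟦ arc M p q ⟧) + (⟦ arc M q p ⟧ - 0ℤ)
          ≡⟨ regroup ⟦ arc M p q ⟧ ⟦ arc M q p ⟧ ⟩
        ι M ∎
        where
        regroup : ∀ a b → (0ℤ - a) + (b - 0ℤ) ≡ b - a
        regroup = solve-∀

    transfer transfer⁻ : Adj n → Adj n
    transfer M = matrix (reflect (rowsOf M))
    transfer⁻ M = matrix (reflect⁻ (rowsOf M))

    transfer⁻∘transfer : ∀ M → 1ℤ ≤ μ (kinds (rowsOf M)) → transfer⁻ (transfer M) ≡ M
    transfer⁻∘transfer M 1≤μ = begin
      matrix (reflect⁻ (rowsOf (transfer M)))        ≡⟨ cong (matrix ∘ reflect⁻) (rowsOf-matrix-flipAt _ M) ⟩
      matrix (reflect⁻ (reflect (rowsOf M)))  ≡⟨ cong matrix (reflect⁻-reflect (rowsOf M) 1≤μ) ⟩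
      matrix (rowsOf M)                       ≡⟨ map-proj₂-zip (tabulate isActive) M ⟩
      M                                       ∎
      where open ≡-Reasoning

    1≤μ⁻-transfer : ∀ M → 1ℤ ≤ μ (kinds (rowsOf M)) → 1ℤ ≤ μ (kinds⁻ (rowsOf (transfer M)))
    1≤μ⁻-transfer M 1≤μ =
      subst (λ X → 1ℤ ≤ μ (kinds⁻ X)) (sym (rowsOf-matrix-flipAt _ M)) (1≤μ-reflect (rowsOf M) 1≤μ)

    colSum-transfer : ∀ M c k → (∀ x → entry c (swapRow x) ≡ entry c x + k * weight (kind x)) →
      1ℤ ≤ μ (kinds (rowsOf M)) → colSum (transfer M) c ≡ colSum M c + k
    colSum-transfer M c k entry-c 1≤μ = trans (colSum-matrix (reflect (rowsOf M)) c)
      (trans (Σ-reflect (entry c) k entry-c (rowsOf M) 1≤μ) (cong (_+ k) (sym (colSum-rowsOf M c))))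

    sorted : Adj n → Adj n
    sorted M = matrix (arrange (rowsOf M))

    colSum-sorted-by : ∀ M c k → (∀ x → entry c (swapRow x) ≡ entry c x + k * weight (kind x)) →
      colSum (sorted M) c ≡ colSum M c
    colSum-sorted-by M c k entry-c = trans (colSum-matrix (arrange (rowsOf M)) c)
      (trans (Σ-arrange (entry c) k entry-c (rowsOf M)) (sym (colSum-rowsOf M c)))

    colSum-sorted : ∀ M c → colSum (sorted M) c ≡ colSum M c
    colSum-sorted M c with c ≟ p | c ≟ q
    ... | yes refl | _ = colSum-sorted-by M c -1ℤ entry-p-swapRow
    ... | no _ | yes refl = colSum-sorted-by M c 1ℤ entry-q-swapRow
    ... | no c≢p | no c≢q = colSum-sorted-by M c 0ℤ (entry-other-swapRow c≢p c≢q)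

    μ-sorted : ∀ M → 0ℤ ≤ σ (kinds (rowsOf M)) → μ (kinds⁻ (rowsOf (sorted M))) ≤ 0ℤ
    μ-sorted M 0≤σ = subst (λ X → μ (kinds⁻ X) ≤ 0ℤ) (sym (rowsOf-matrix-flipAt _ M)) (μ-arrange (rowsOf M) 0≤σ)

    ι≤1 : ∀ M → ι M ≤ 1ℤ
    ι≤1 M with arc M q p | arc M p q
    ... | true | true = +≤+ z≤n
    ... | true | false = ℤ.≤-refl
    ... | false | true = -≤+
    ... | false | false = +≤+ z≤n

    ι≤0 : ∀ M → (arc M q p ≡ true → arc M p q ≡ true) → ι M ≤ 0ℤ
    ι≤0 M qp⇒pq with arc M q p | arc M p q
    ... | true | true = ℤ.≤-refl
    ... | true | false = contradiction (qp⇒pq refl) λ ()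
    ... | false | true = -≤+
    ... | false | false = ℤ.≤-refl

    module _ {u v b : Vec ℕ n} (u-p : lookup u p ≡ suc (lookup v p)) (v-q : lookup v q ≡ suc (lookup u q))
             (u≡v : ∀ c → c ≢ p → c ≢ q → lookup u c ≡ lookup v c) (vq≤vp : lookup v q ℕ.≤ lookup v p) where

      colSum-realizationᵘ : ∀ M → IsRealization u b M → ∀ c → colSum M c ≡ + lookup u c
      colSum-realizationᵘ M = colSum-realization {a = u} {b} {M}

      colSum-realizationᵛ : ∀ M → IsRealization v b M → ∀ c → colSum M c ≡ + lookup v c
      colSum-realizationᵛ M = colSum-realization {a = v} {b} {M}

      σ-lower-bound : ∀ a M → IsRealization a b M → ∀ k d → lookup a q ℕ.+ k ℕ.≤ lookup a p → ι M ≤ d →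
        + k - d ≤ σ (kinds (rowsOf M))
      σ-lower-bound a M R k d bound ι≤d =
        summand-lower-bound (σ (kinds (rowsOf M))) (ι M) (+ k) d {x = + lookup a p} {y = + lookup a q}
          (trans (sym (colSum≡ p)) (trans (column-difference M (proj₁ R)) (cong (_+ (σ (kinds (rowsOf M)) + ι M)) (colSum≡ q))))
          (+≤+ bound) ι≤d
        where colSum≡ = colSum-realization {a = a} {b} {M} R

      1≤μ-realization : ∀ {M} → IsRealization u b M → 1ℤ ≤ μ (kinds (rowsOf M))
      1≤μ-realization {M} R = ℤ.≤-trans (σ-lower-bound u M R 2 1ℤ uq+2≤up (ι≤1 M)) (σ≤μ (kinds (rowsOf M)))
        where
        uq+2≤up : lookup u q ℕ.+ 2 ℕ.≤ lookup u p
        uq+2≤up rewrite ℕ.+-comm (lookup u q) 2 | u-p = s≤s (subst (ℕ._≤ lookup v p) v-q vq≤vp)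

      transfer-realization : ∀ {M} → IsRealization u b M → IsRealization v b (transfer M)
      transfer-realization {M} R = RowsTransposed-realization {a = u} {v} {b} M (transfer M)
        (matrix-flipAt-transposed (reflectFlags (kinds (rowsOf M))) M) R colSum-transfer′
        where
        1≤μ = 1≤μ-realization R
        colSum-transfer′ : ∀ c → colSum (transfer M) c ≡ + lookup v c
        colSum-transfer′ c with c ≟ p | c ≟ q
        ... | yes refl | _ = trans (colSum-transfer M p -1ℤ entry-p-swapRow 1≤μ)
              (trans (cong (_+ -1ℤ) (trans (colSum-realizationᵘ M R p) (trans (cong +_ u-p) (ℤ.pos-+ 1 (lookup v p)))))
                     (suc-pred (+ lookup v p)))
        ... | no _ | yes refl = trans (colSum-transfer M q 1ℤ entry-q-swapRow 1≤μ)
              (trans (cong (_+ 1ℤ) (colSum-realizationᵘ M R q))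
                     (trans (ℤ.+-comm (+ lookup u q) 1ℤ) (trans (sym (ℤ.pos-+ 1 (lookup u q))) (cong +_ (sym v-q)))))
        ... | no c≢p | no c≢q = trans (colSum-transfer M c 0ℤ (entry-other-swapRow c≢p c≢q) 1≤μ)
              (trans (ℤ.+-identityʳ _) (trans (colSum-realizationᵘ M R c) (cong +_ (u≡v c c≢p c≢q))))

      sorted-realization : ∀ {M} → IsRealization v b M → IsRealization v b (sorted M)
      sorted-realization {M} R = RowsTransposed-realization {a = v} {v} {b} M (sorted M)
        (matrix-flipAt-transposed (arrangeFlags (ups (kinds⁻ (rowsOf M))) (kinds⁻ (rowsOf M))) M) R
        (λ c → trans (colSum-sorted M c) (colSum-realizationᵛ M R c))

      N₂-transfer-≤ : N₂ u b ℕ.≤ N₂ v b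
      N₂-transfer-≤ = length-filter-≤ (isRealization? u b) (isRealization? v b) (allAdj-unique n)
        (allAdj-complete n) transfer transfer⁻ transfer-realization (λ R → transfer⁻∘transfer _ (1≤μ-realization R))

      N₂-transfer-< : ∀ M → IsRealization v b M →
        lookup v q ℕ.< lookup v p ⊎ (arc M q p ≡ true → arc M p q ≡ true) → N₂ u b ℕ.< N₂ v b
      N₂-transfer-< M R condition = length-filter-< (isRealization? u b) (isRealization? v b) (allAdj-unique n)
        (allAdj-complete n) transfer transfer⁻ transfer-realization (λ R → transfer⁻∘transfer _ (1≤μ-realization R))
        (sorted M) (sorted-realization R) missed
        where
        0≤σ : 0ℤ ≤ σ (kinds (rowsOf M))
        0≤σ = [ (λ vq<vp → σ-lower-bound v M R 1 1ℤ (subst (ℕ._≤ lookup v p) (ℕ.+-comm 1 (lookup v q)) vq<vp)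
                                          (ι≤1 M))
              , (λ qp⇒pq → σ-lower-bound v M R 0 0ℤ (subst (ℕ._≤ lookup v p) (sym (ℕ.+-identityʳ (lookup v q))) vq≤vp)
                                          (ι≤0 M qp⇒pq))
              ] condition
        missed : ∀ {M′} → IsRealization u b M′ → transfer M′ ≢ sorted M
        missed {M′} R′ transfer≡sorted
          with ℤ.≤-trans (subst (λ X → 1ℤ ≤ μ (kinds⁻ (rowsOf X))) transfer≡sorted
                                (1≤μ⁻-transfer M′ (1≤μ-realization R′)))
                         (μ-sorted M 0≤σ)
        ... | +≤+ ()

module Switching where

  open Sums
  open Realizations using (arc; colSum; RowsTransposed; RowsTransposed-realization; colSum-realization)
  open import Data.Nat as ℕ using (ℕ)
  open import Data.Bool using (true; false)
  open import Data.Fin using (Fin; _≟_)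
  open import Data.Fin.Permutation.Components using (transpose)
  open import Data.Vec using (Vec; lookup; updateAt)
  open import Data.Vec.Properties using (lookup∘updateAt; lookup∘updateAt′)
  open import Data.Integer using (+_; _≤_; +≤+)
  import Data.Integer.Properties as ℤ
  open import Algebra.Properties.CommutativeMonoid.Sum ℤ.+-0-commutativeMonoid using (sum; sum-cong-≗)
  open import Data.Product using (∃; _×_; _,_)
  open import Data.Sum using (inj₁; inj₂)
  open import Function using (_∘_)
  open import Relation.Nullary using (yes; no; contradiction)
  open import Relation.Binary.PropositionalEquality using (_≡_; _≢_; ≢-sym; refl; sym; trans; cong; subst₂)

  colSum-rows-transposed : ∀ {n} (M M′ : Adj n) c (x y : Fin n) →
    (∀ i → arc M′ i c ≡ arc M (transpose x y i) c) → colSum M′ c ≡ colSum M c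
  colSum-rows-transposed M M′ c x y arc≡ =
    trans (sum-cong-≗ (cong ⟦_⟧ ∘ arc≡)) (sym (sum-transpose x y (λ i → ⟦ arc M i c ⟧)))

  -- Replace the arcs q→p, w→q, p→z by w→p, p→q, q→z, exchanging two entries in each of the rows w, p, q.
  module TripleSwitch {n} (M : Adj n) {p q w z : Fin n}
    (p≢q : p ≢ q) (w≢p : w ≢ p) (w≢q : w ≢ q) (z≢p : z ≢ p) (z≢q : z ≢ q)
    (qp : arc M q p ≡ true) (pq : arc M p q ≡ false) (wq : arc M w q ≡ true) (wp : arc M w p ≡ false)
    (pz : arc M p z ≡ true) (qz : arc M q z ≡ false) where

    M₁ M₂ switched : Adj n
    M₁ = updateAt M w (swapCols p q)
    M₂ = updateAt M₁ p (swapCols q z)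
    switched = updateAt M₂ q (swapCols p z)

    row-w : lookup switched w ≡ swapCols p q (lookup M w)
    row-w = trans (lookup∘updateAt′ w q {swapCols p z} w≢q M₂)
           (trans (lookup∘updateAt′ w p {swapCols q z} w≢p M₁) (lookup∘updateAt w {swapCols p q} M))

    row-p : lookup switched p ≡ swapCols q z (lookup M p)
    row-p = trans (lookup∘updateAt′ p q {swapCols p z} p≢q M₂)
      (trans (lookup∘updateAt p {swapCols q z} M₁)
             (cong (swapCols q z) (lookup∘updateAt′ p w {swapCols p q} (≢-sym w≢p) M)))

    row-q : lookup switched q ≡ swapCols p z (lookup M q)
    row-q = trans (lookup∘updateAt q {swapCols p z} M₂)
      (cong (swapCols p z) (trans (lookup∘updateAt′ q p {swapCols q z} (≢-sym p≢q) M₁)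
                                  (lookup∘updateAt′ q w {swapCols p q} (≢-sym w≢q) M)))

    row-other : ∀ {i} → i ≢ w → i ≢ p → i ≢ q → lookup switched i ≡ lookup M i
    row-other {i} i≢w i≢p i≢q = trans (lookup∘updateAt′ i q {swapCols p z} i≢q M₂)
      (trans (lookup∘updateAt′ i p {swapCols q z} i≢p M₁) (lookup∘updateAt′ i w {swapCols p q} i≢w M))

    by-row : ∀ {P : Fin n → Set} → P w → P p → P q → (∀ {i} → i ≢ w → i ≢ p → i ≢ q → P i) →
      ∀ i → P i
    by-row Pw Pp Pq Po i with i ≟ w | i ≟ p | i ≟ q
    ... | yes refl | _ | _ = Pw
    ... | no _ | yes refl | _ = Pp
    ... | no _ | no _ | yes refl = Pq
    ... | no i≢w | no i≢p | no i≢q = Po i≢w i≢p i≢q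

    transposed : RowsTransposed M switched
    transposed = by-row
      (inj₂ (p , q , w≢p , w≢q , row-w))
      (inj₂ (q , z , p≢q , ≢-sym z≢p , row-p))
      (inj₂ (p , z , ≢-sym p≢q , ≢-sym z≢q , row-q))
      (λ i≢w i≢p i≢q → inj₁ (row-other i≢w i≢p i≢q))

    arc-w : ∀ c → arc switched w c ≡ arc M w (transpose p q c)
    arc-w c = trans (cong (λ r → lookup r c) row-w) (lookup-swapCols p q (lookup M w) c)

    arc-p : ∀ c → arc switched p c ≡ arc M p (transpose q z c)
    arc-p c = trans (cong (λ r → lookup r c) row-p) (lookup-swapCols q z (lookup M p) c)

    arc-q : ∀ c → arc switched q c ≡ arc M q (transpose p z c)
    arc-q c = trans (cong (λ r → lookup r c) row-q) (lookup-swapCols p z (lookup M q) c)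

    arc-other : ∀ {i} → i ≢ w → i ≢ p → i ≢ q → ∀ c → arc switched i c ≡ arc M i c
    arc-other i≢w i≢p i≢q c = cong (λ r → lookup r c) (row-other i≢w i≢p i≢q)

    fixed : ∀ {x y c : Fin n} → c ≢ x → c ≢ y → ∀ i → arc M i (transpose x y c) ≡ arc M i c
    fixed c≢x c≢y i = cong (arc M i) (transpose-other c≢x c≢y)

    fixedʳ : ∀ {x y i : Fin n} c → i ≢ x → i ≢ y → arc M (transpose x y i) c ≡ arc M i c
    fixedʳ c i≢x i≢y = cong (λ i → arc M i c) (transpose-other i≢x i≢y)

    matchˡ : ∀ (x y : Fin n) c → arc M (transpose x y x) c ≡ arc M y c
    matchˡ x y c = cong (λ i → arc M i c) (transpose-matchˡ x y)

    matchʳ : ∀ (x y : Fin n) c → arc M (transpose x y y) c ≡ arc M x c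
    matchʳ x y c = cong (λ i → arc M i c) (transpose-matchʳ x y)

    column-p : ∀ i → arc switched i p ≡ arc M (transpose w q i) p
    column-p = by-row
      (trans (arc-w p) (trans (cong (arc M w) (transpose-matchˡ p q)) (trans wq (trans (sym qp) (sym (matchˡ w q p))))))
      (trans (arc-p p) (trans (fixed p≢q (≢-sym z≢p) p) (sym (fixedʳ p (≢-sym w≢p) p≢q))))
      (trans (arc-q p) (trans (cong (arc M q) (transpose-matchˡ p z)) (trans qz (trans (sym wp) (sym (matchʳ w q p))))))
      (λ i≢w i≢p i≢q → trans (arc-other i≢w i≢p i≢q p) (sym (fixedʳ p i≢w i≢q)))

    column-q : ∀ i → arc switched i q ≡ arc M (transpose w p i) q
    column-q = by-row
      (trans (arc-w q) (trans (cong (arc M w) (transpose-matchʳ p q)) (trans wp (trans (sym pq) (sym (matchˡ w p q))))))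
      (trans (arc-p q) (trans (cong (arc M p) (transpose-matchˡ q z)) (trans pz (trans (sym wq) (sym (matchʳ w p q))))))
      (trans (arc-q q) (trans (fixed (≢-sym p≢q) (≢-sym z≢q) q) (sym (fixedʳ q (≢-sym w≢q) (≢-sym p≢q)))))
      (λ i≢w i≢p i≢q → trans (arc-other i≢w i≢p i≢q q) (sym (fixedʳ q i≢w i≢p)))

    column-z : ∀ i → arc switched i z ≡ arc M (transpose p q i) z
    column-z = by-row
      (trans (arc-w z) (trans (fixed z≢p z≢q w) (sym (fixedʳ z w≢p w≢q))))
      (trans (arc-p z) (trans (cong (arc M p) (transpose-matchʳ q z)) (trans pq (trans (sym qz) (sym (matchˡ p q z))))))
      (trans (arc-q z) (trans (cong (arc M q) (transpose-matchʳ p z)) (trans qp (trans (sym pz) (sym (matchʳ p q z))))))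
      (λ i≢w i≢p i≢q → trans (arc-other i≢w i≢p i≢q z) (sym (fixedʳ z i≢p i≢q)))

    column-other : ∀ {c} → c ≢ p → c ≢ q → c ≢ z → ∀ i → arc switched i c ≡ arc M i c
    column-other {c} c≢p c≢q c≢z = by-row
      (trans (arc-w c) (fixed c≢p c≢q w)) (trans (arc-p c) (fixed c≢q c≢z p)) (trans (arc-q c) (fixed c≢p c≢z q))
      (λ i≢w i≢p i≢q → arc-other i≢w i≢p i≢q c)

    colSum-switched : ∀ c → colSum switched c ≡ colSum M c
    colSum-switched c with c ≟ p | c ≟ q | c ≟ z
    ... | yes refl | _ | _ = colSum-rows-transposed M switched p w q column-p
    ... | no _ | yes refl | _ = colSum-rows-transposed M switched q w p column-q
    ... | no _ | no _ | yes refl = colSum-rows-transposed M switched z p q column-z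
    ... | no c≢p | no c≢q | no c≢z = sum-cong-≗ (cong ⟦_⟧ ∘ column-other c≢p c≢q c≢z)

    switched-realization : ∀ {a b} → IsRealization a b M → IsRealization a b switched
    switched-realization {a} {b} R = RowsTransposed-realization {a = a} {a} {b} M switched transposed R
      (λ c → trans (colSum-switched c) (colSum-realization {a = a} {b} {M} R c))

    switched-qp : arc switched q p ≡ false
    switched-qp = trans (arc-q p) (trans (cong (arc M q) (transpose-matchˡ p z)) qz)

  arc-order : ∀ {n} {a b : Vec ℕ n} {p q : Fin n} → Digraphic a b → p ≢ q →
    lookup a p ≡ lookup a q → lookup b q ℕ.≤ lookup b p →
    ∃ λ M → IsRealization a b M × (arc M q p ≡ true → arc M p q ≡ true)
  arc-order {a = a} {b} {p} {q} (M , R@(loopless , _ , outdeg≡b)) p≢q ap≡aq bq≤bp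
    with arc M q p in qp | arc M p q in pq
  ... | false | _ = M , R , λ qp′ → contradiction (trans (sym qp) qp′) λ ()
  ... | true | true = M , R , λ _ → pq
  ... | true | false with compensating-index (λ i → arc M i q) (λ i → arc M i p) q (loopless q) qp colSums
                        | compensating-index (λ j → arc M p j) (λ j → arc M q j) p (loopless p) qp rowSums
    where
    colSums : colSum M p ≤ colSum M q
    colSums = ℤ.≤-reflexive (trans (colSum-realization {a = a} {b} {M} R p)
                                   (trans (cong +_ ap≡aq) (sym (colSum-realization {a = a} {b} {M} R q))))
    rowSum≡b : ∀ i → sum (λ j → ⟦ arc M i j ⟧) ≡ + lookup b i
    rowSum≡b i = trans (sym (bsum≡sum (lookup M i))) (cong +_ (outdeg≡b i))
    rowSums : sum (λ j → ⟦ arc M q j ⟧) ≤ sum (λ j → ⟦ arc M p j ⟧)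
    rowSums = subst₂ _≤_ (sym (rowSum≡b q)) (sym (rowSum≡b p)) (+≤+ bq≤bp)
  ...   | w , w≢q , wq , wp | z , z≢p , pz , qz =
    switched , switched-realization {a = a} {b} R , λ qp′ → contradiction (trans (sym switched-qp) qp′) λ ()
    where
    w≢p : w ≢ p
    w≢p = λ { refl → contradiction (trans (sym wq) pq) λ () }
    z≢q : z ≢ q
    z≢q = λ { refl → contradiction (trans (sym pz) pq) λ () }
    open TripleSwitch M p≢q w≢p w≢q z≢p z≢q qp pq wq wp pz qz

module Majorization where

  open import Data.Nat using (ℕ; zero; suc; _+_; _∸_; _≤_; _<_; z≤n; s≤s; _≤?_; _≟_)
  import Data.Nat.Properties as ℕ
  open import Data.Nat.ListAction using (sum)
  open import Data.Fin using (Fin; zero; suc; toℕ)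
  open import Data.Vec using (Vec; []; _∷_; lookup; toList)
  open import Data.List using (take)
  open import Data.List.Properties using (take-all)
  open import Data.Vec.Properties using (length-toList)
  open import Data.Product using (_×_; _,_)
  open import Function using (_∘′_)
  open import Relation.Nullary using (¬_; yes; no; contradiction)
  open import Relation.Binary.PropositionalEquality
    using (_≡_; _≢_; refl; sym; trans; cong; subst; subst₂; module ≡-Reasoning)

  -- Maj s a w: each partial sum of a is at most s plus that of w, with equality for the full sums
  Maj : ∀ {k} → ℕ → Vec ℕ k → Vec ℕ k → Set
  Maj s [] [] = s ≡ 0
  Maj s (x ∷ a) (y ∷ w) = x ≤ s + y × Maj (s + y ∸ x) a w

  excess : ∀ {k} → Vec ℕ k → Vec ℕ k → ℕ
  excess [] [] = 0
  excess (x ∷ a) (y ∷ w) = (y ∸ x) + excess a w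

  record Raise {k} (s : ℕ) (a w : Vec ℕ k) : Set where
    field
      u : Vec ℕ k
      q : Fin k
      w<a : lookup w q < lookup a q
      u-q : lookup u q ≡ suc (lookup w q)
      u-other : ∀ c → c ≢ q → lookup u c ≡ lookup w c
      maj : Maj s a u
      excess-u : excess a u ≡ excess a w

  raise : ∀ {k} s (a w : Vec ℕ k) → Maj (suc s) a w → Raise s a w
  raise s [] [] ()
  raise s (x ∷ a) (y ∷ w) (x≤ , maj) with x ≤? s + y
  ... | yes x≤s+y = record
    { u = y ∷ R.u ; q = suc R.q ; w<a = R.w<a ; u-q = R.u-q
    ; u-other = λ { zero _ → refl ; (suc c) c≢q → R.u-other c (c≢q ∘′ cong suc) }
    ; maj = x≤s+y , R.maj ; excess-u = cong ((y ∸ x) +_) R.excess-u }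
    where
    module R = Raise (raise (s + y ∸ x) a w (subst (λ t → Maj t a w) (ℕ.+-∸-assoc 1 x≤s+y) maj))
  ... | no x≰s+y = record
    { u = suc y ∷ w ; q = zero ; w<a = y<x ; u-q = refl
    ; u-other = λ { zero 0≢0 → contradiction refl 0≢0 ; (suc c) _ → refl }
    ; maj = subst (λ t → x ≤ t × Maj (t ∸ x) a w) (sym (ℕ.+-suc s y)) (x≤ , maj)
    ; excess-u = cong (_+ excess a w) (trans (ℕ.m≤n⇒m∸n≡0 y<x) (sym (ℕ.m≤n⇒m∸n≡0 (ℕ.<⇒≤ y<x)))) }
    where
    y<x : y < x
    y<x = ℕ.≤-<-trans (ℕ.m≤n+m y s) (ℕ.≰⇒> x≰s+y)

  record Move {k} (a w : Vec ℕ k) : Set where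
    field
      u : Vec ℕ k
      p q : Fin k
      p<q : toℕ p < toℕ q
      a<w : lookup a p < lookup w p
      w<a : lookup w q < lookup a q
      w-p : lookup w p ≡ suc (lookup u p)
      u-q : lookup u q ≡ suc (lookup w q)
      u-other : ∀ c → c ≢ p → c ≢ q → lookup u c ≡ lookup w c
      maj : Maj 0 a u
      excess-u : suc (excess a u) ≡ excess a w

  move : ∀ {k} (a w : Vec ℕ k) → Maj 0 a w → a ≢ w → Move a w
  move [] [] _ a≢w = contradiction refl a≢w
  move (x ∷ a) (y ∷ w) (x≤y , maj) a≢w with x ≟ y
  ... | yes refl = record
    { u = x ∷ M.u ; p = suc M.p ; q = suc M.q ; p<q = s≤s M.p<q ; a<w = M.a<w ; w<a = M.w<a
    ; w-p = M.w-p ; u-q = M.u-q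
    ; u-other = λ { zero _ _ → refl ; (suc c) c≢p c≢q → M.u-other c (c≢p ∘′ cong suc) (c≢q ∘′ cong suc) }
    ; maj = ℕ.≤-refl , subst (λ t → Maj t a M.u) (sym (ℕ.n∸n≡0 x)) M.maj
    ; excess-u = trans (sym (ℕ.+-suc (x ∸ x) _)) (cong ((x ∸ x) +_) M.excess-u) }
    where
    module M = Move (move a w (subst (λ t → Maj t a w) (ℕ.n∸n≡0 x) maj) (a≢w ∘′ cong (x ∷_)))
  ... | no x≢y with ℕ.≤∧≢⇒< x≤y x≢y
  ...   | s≤s {n = y′} x≤y′ = record
    { u = y′ ∷ R.u ; p = zero ; q = suc R.q ; p<q = s≤s z≤n ; a<w = s≤s x≤y′ ; w<a = R.w<a
    ; w-p = refl ; u-q = R.u-q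
    ; u-other = λ { zero 0≢0 _ → contradiction refl 0≢0 ; (suc c) _ c≢q → R.u-other c (c≢q ∘′ cong suc) }
    ; maj = x≤y′ , R.maj
    ; excess-u = trans (cong (λ e → suc ((y′ ∸ x) + e)) R.excess-u)
                       (cong (_+ excess a w) (sym (ℕ.+-∸-assoc 1 x≤y′))) }
    where
    module R = Raise (raise (y′ ∸ x) a w (subst (λ t → Maj t a w) (ℕ.+-∸-assoc 1 x≤y′) maj))

  total : ∀ {k} → Vec ℕ k → ℕ
  total v = sum (toList v)

  prefixSums⇒Maj : ∀ {k} s (a w : Vec ℕ k) →
    (∀ j → prefixSum a j ≤ s + prefixSum w j) → total a ≡ s + total w → Maj s a w
  prefixSums⇒Maj s [] [] _ total≡ = trans (sym (ℕ.+-identityʳ s)) (sym total≡)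
  prefixSums⇒Maj s (x ∷ a) (y ∷ w) prefix≤ total≡ = x≤s+y ,
    prefixSums⇒Maj (s + y ∸ x) a w
      (λ j → ℕ.+-cancelˡ-≤ x _ _ (subst (x + prefixSum a j ≤_) (regroup (prefixSum w j)) (prefix≤ (suc j))))
      (ℕ.+-cancelˡ-≡ x _ _ (trans total≡ (regroup (total w))))
    where
    x≤s+y : x ≤ s + y
    x≤s+y = subst₂ _≤_ (ℕ.+-identityʳ x) (cong (s +_) (ℕ.+-identityʳ y)) (prefix≤ 1)
    regroup : ∀ t → s + (y + t) ≡ x + ((s + y ∸ x) + t)
    regroup t = begin
      s + (y + t)              ≡⟨ ℕ.+-assoc s y t ⟨
      (s + y) + t              ≡⟨ cong (_+ t) (ℕ.m+[n∸m]≡n x≤s+y) ⟨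
      (x + (s + y ∸ x)) + t    ≡⟨ ℕ.+-assoc x _ t ⟩
      x + ((s + y ∸ x) + t)    ∎
      where open ≡-Reasoning

  ∸1-bound : ∀ m j → ¬ (suc j ≤ m ∸ 1) → m ≤ suc j
  ∸1-bound zero j _ = z≤n
  ∸1-bound (suc m) j j≮m = s≤s (ℕ.≮⇒≥ j≮m)

  ≺⇒Maj : ∀ {n} {a w : Vec ℕ n} → a ≺ w → Maj 0 a w
  ≺⇒Maj {n} {a} {w} (prefix≤ , total≡) = prefixSums⇒Maj 0 a w all-prefixes total≡
    where
    prefix-total : ∀ (v : Vec ℕ n) j → n ≤ j → prefixSum v j ≡ total v
    prefix-total v j n≤j = cong sum (take-all j (toList v) (subst (_≤ j) (sym (length-toList v)) n≤j))
    all-prefixes : ∀ j → prefixSum a j ≤ prefixSum w j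
    all-prefixes zero = z≤n
    all-prefixes (suc j) with suc j ≤? n ∸ 1
    ... | yes j<n = prefix≤ (suc j) (s≤s z≤n) j<n
    ... | no j≮n = ℕ.≤-reflexive (trans (prefix-total a (suc j) n≤1+j)
                                      (trans total≡ (sym (prefix-total w (suc j) n≤1+j))))
      where
      n≤1+j : n ≤ suc j
      n≤1+j = ∸1-bound n j j≮n

module Descent where

  open Realizations using (arc)
  open IndegreeTransfer using (module ColumnTransfer)
  open Switching using (arc-order)
  open Majorization
  open import Data.Nat as ℕ using (ℕ; zero; suc; _∸_; _+_; _≤_; _<_; _>_)
  import Data.Nat.Properties as ℕ
  open import Data.Fin using (Fin; toℕ; fromℕ<)
  open import Data.Fin.Properties using (toℕ-fromℕ<; toℕ<n)
  open import Data.Vec using (Vec; lookup)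
  open import Data.Vec.Properties using (≡-dec)
  open import Data.Product using (_,_)
  open import Data.Sum using (inj₁; inj₂)
  open import Relation.Nullary using (yes; no; contradiction)
  open import Relation.Binary.PropositionalEquality using (_≡_; _≢_; refl; sym; trans; cong; subst)

  ≥lex-trans : ∀ {x y x′ y′ x″ y″} →
    (x , y) ≥lex (x′ , y′) → (x′ , y′) ≥lex (x″ , y″) → (x , y) ≥lex (x″ , y″)
  ≥lex-trans (inj₁ x>x′) (inj₁ x′>x″) = inj₁ (ℕ.<-trans x′>x″ x>x′)
  ≥lex-trans (inj₁ x>x′) (inj₂ (refl , _)) = inj₁ x>x′
  ≥lex-trans (inj₂ (refl , _)) (inj₁ x′>x″) = inj₁ x′>x″
  ≥lex-trans (inj₂ (refl , y≥y′)) (inj₂ (refl , y′≥y″)) = inj₂ (refl , ℕ.≤-trans y′≥y″ y≥y′)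

  module _ {n} {a b : Vec ℕ n} (lex : LexNonincreasing a b) where

    lex-ordered : ∀ (i j : Fin n) → toℕ i < toℕ j → (lookup a i , lookup b i) ≥lex (lookup a j , lookup b j)
    lex-ordered i j i<j =
      at-gap (toℕ j ∸ suc (toℕ i)) j (sym (trans (cong suc (ℕ.+-comm _ (toℕ i))) (ℕ.m+[n∸m]≡n i<j)))
      where
      at-gap : ∀ d (j : Fin n) → toℕ j ≡ suc (d + toℕ i) → (lookup a i , lookup b i) ≥lex (lookup a j , lookup b j)
      at-gap zero j j≡ = lex i j j≡
      at-gap (suc d) j j≡ =
        ≥lex-trans (at-gap d k (toℕ-fromℕ< k<n)) (lex k j (trans j≡ (cong suc (sym (toℕ-fromℕ< k<n)))))
        where
        k<n : suc (d + toℕ i) < n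
        k<n = ℕ.<-trans (subst (suc (d + toℕ i) <_) (sym j≡) (ℕ.n<1+n _)) (toℕ<n j)
        k = fromℕ< k<n

    module _ (dig : Digraphic a b) where

      module Step {w : Vec ℕ n} (m : Move a w) where
        open Move m

        p≢q : p ≢ q
        p≢q p≡q = ℕ.<-irrefl (cong toℕ p≡q) p<q

        uq≤up : lookup u q ≤ lookup u p
        uq≤up = ℕ.≤-trans (subst (_≤ lookup a q) (sym u-q) w<a)
                          (ℕ.≤-trans aq≤ap (ℕ.≤-pred (subst (lookup a p <_) w-p a<w)))
          where
          aq≤ap : lookup a q ≤ lookup a p
          aq≤ap with lex-ordered p q p<q
          ... | inj₁ aq<ap = ℕ.<⇒≤ aq<ap
          ... | inj₂ (ap≡aq , _) = ℕ.≤-reflexive (sym ap≡aq)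

        open ColumnTransfer p≢q using (N₂-transfer-≤; N₂-transfer-<)

        w≡u : ∀ c → c ≢ p → c ≢ q → lookup w c ≡ lookup u c
        w≡u c c≢p c≢q = sym (u-other c c≢p c≢q)

        N₂-step-≤ : N₂ w b ≤ N₂ u b
        N₂-step-≤ = N₂-transfer-≤ {u = w} {v = u} {b = b} w-p u-q w≡u uq≤up

        N₂-last-step : a ≡ u → N₂ w b < N₂ a b
        N₂-last-step a≡u = subst (λ v → N₂ w b < N₂ v b) (sym a≡u) (last (lex-ordered p q p<q))
          where
          step-< = N₂-transfer-< {u = w} {v = u} {b = b} w-p u-q w≡u uq≤up
          last : (lookup a p , lookup b p) ≥lex (lookup a q , lookup b q) → N₂ w b < N₂ u b
          last (inj₁ aq<ap) = let M , R = subst (λ v → Digraphic v b) a≡u dig in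
            step-< M R (inj₁ (subst (λ v → lookup v q < lookup v p) a≡u aq<ap))
          last (inj₂ (ap≡aq , bq≤bp)) = let M , R , qp⇒pq = arc-order {a = a} {b} dig p≢q ap≡aq bq≤bp in
            step-< M (subst (λ v → IsRealization v b M) a≡u R) (inj₂ qp⇒pq)

      descent : ∀ e (w : Vec ℕ n) → excess a w ≡ e → Maj 0 a w → a ≢ w → N₂ w b < N₂ a b
      descent e w excess≡ maj a≢w with move a w maj a≢w
      ... | m with e | ≡-dec ℕ._≟_ a (Move.u m)
      ...   | zero | _ = contradiction (trans (Move.excess-u m) excess≡) λ ()
      ...   | suc e′ | yes a≡u = Step.N₂-last-step m a≡u
      ...   | suc e′ | no a≢u =
        ℕ.≤-<-trans (Step.N₂-step-≤ m)
          (descent e′ (Move.u m) (ℕ.suc-injective (trans (Move.excess-u m) excess≡)) (Move.maj m) a≢u)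

corollary5 : ∀ {n} (a a' b : Vec ℕ n) →
    LexNonincreasing a b → Digraphic a b →
    Digraphic a' b → a ≢ a' → a ≺ a' →
    N₂ a b > N₂ a' b
corollary5 a a' b lex dig _ a≢a' a≺a' =
  Descent.descent {b = b} lex dig (Majorization.excess a a') a' refl (Majorization.≺⇒Maj a≺a') a≢a'
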